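{- Let $k$ be a fixed positive integer, and let $f_1, f_2, f_3, \dots$ be a sequence of functions where $f_i : \{1,\dots,i\} \to \{1,\dots,i\}$ is a $k$-max function for each $i$. For each $n$, let $D(f_n)$ denote the number of $f_n$-derangements. Then $$\lim_{n\to\infty} \frac{D(f_n)}{n!} = \frac{1}{e}.$$
   Context: For a function $f:\{1,\dots,n\}\to\{1,\dots,n\}$ (not necessarily one-to-one), an $f$-derangement is a permutation $g$ of $\{1,\dots,n\}$ such that $g(i)\neq f(i)$ for every $i=1,\dots,n$. A function $f$ is called a $k$-max function if every value has at most $k$ preimages under $f$, i.e. $|f^{ -1}(y)|\le k$ for every $y$. -}

module Defs where

open import Data.Nat using (ℕ; zero; suc; _!; _≤_)
open import Data.Nat.Properties using (_!≢0)
open import Data.Fin using (Fin; zero; suc)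
open import Data.Fin.Properties using (all?) renaming (_≟_ to _≟ᶠ_)
open import Data.List using (List; []; _∷_; length; filter; concatMap; map)
open import Data.Integer using (ℤ; +_; -_)
open import Data.Rational using (ℚ; _/_; _+_; _-_; ∣_∣; _<_; 0ℚ)
open import Data.Product using (_×_; ∃-syntax)
open import Relation.Binary.PropositionalEquality using (_≡_; _≢_)
open import Relation.Nullary using (Dec; ¬_)
open import Relation.Nullary.Decidable using (_×-dec_; _→-dec_; ¬?)
open import Relation.Unary using (Decidable)

preimageCount : ∀ {n m} → (Fin n → Fin m) → Fin m → ℕ
preimageCount {n} f y = length (filter (λ x → f x ≟ᶠ y) (Data.List.allFin n))
  where import Data.List

KMax : ℕ → ∀ {n} → (Fin n → Fin n) → Set
KMax k {n} f = ∀ (y : Fin n) → preimageCount f y ≤ k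

allFuns : (n m : ℕ) → List (Fin n → Fin m)
allFuns zero    m = (λ ()) ∷ []
allFuns (suc n) m =
  concatMap (λ g → map (λ (a : Fin m) → λ { zero → a ; (suc i) → g i })
                       (Data.List.allFin m))
            (allFuns n m)
  where import Data.List

-- g is an f-derangement: g is a permutation (an injective, hence bijective,
-- self-map of the finite set Fin n) with g i ≢ f i for every i.
IsDerangement : ∀ {n} → (f : Fin n → Fin n) → (g : Fin n → Fin n) → Set
IsDerangement {n} f g =
  (∀ (i j : Fin n) → g i ≡ g j → i ≡ j) × (∀ (i : Fin n) → g i ≢ f i)

isDerangement? : ∀ {n} (f : Fin n → Fin n) → Decidable (IsDerangement f)
isDerangement? f g =
  all? (λ i → all? (λ j → (g i ≟ᶠ g j) →-dec (i ≟ᶠ j)))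
  ×-dec all? (λ i → ¬? (g i ≟ᶠ f i))

D : ∀ {n} → (Fin n → Fin n) → ℕ
D {n} f = length (filter (isDerangement? f) (allFuns n n))

ratio : ∀ {n} → (Fin n → Fin n) → ℚ
ratio {n} f = (+ D f / (n !)) {{n !≢0}}

-- Partial sums s_m = Σ_{j=0}^{m} (-1)^j / j!, a Cauchy sequence of rationals
-- converging to 1/e (this is the standard series definition of 1/e).
sign : ℕ → ℤ
sign zero = + 1
sign (suc j) = - sign j

invESum : ℕ → ℚ
invESum zero    = (+ 1 / 1)
invESum (suc m) = invESum m + (sign (suc m) / (suc m !)) {{suc m !≢0}}

-- A rational sequence a converges to 1/e: for every rational ε > 0 there is N
-- with |a n - s m| < ε for all n, m ≥ N (s = partial sums above).  Since s → 1/e,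
-- this is equivalent to a n → 1/e.
ConvergesToInvE : (ℕ → ℚ) → Set
ConvergesToInvE a =
  ∀ (ε : ℚ) → 0ℚ < ε → ∃[ N ] (∀ n m → N ≤ n → N ≤ m → ∣ a n - invESum m ∣ < ε)

-- D(f) counts the placements of n non-attacking rooks on the n × n board avoiding the cells
-- (i, f i).  Removing the forbidden cells one at a time (deletion–contraction) compares it with
-- the board whose forbidden cells lie in distinct rows and columns, which has the classical
-- derangement number dₙ of placements.  Since every column is forbidden at most k times, each
-- contraction spoils at most k − 1 further constraints, and the accumulated error is at most
-- 3 (k − 1) n (n − 2)! = o(n!).  Finally dₙ/n! is the n-th partial sum of ∑ (−1)ʲ/j!, and
-- ∣dₙ/n! − dₘ/m!∣ ≤ 1/n! + 1/m!.
module Submission where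

open import Defs
open import Data.Nat.Properties
  using (+-*-semiring; +-identityʳ; suc-injective; ≤-refl; ≤-trans; ≤-reflexive; n≤1+n; m≤m+n; m≤n+m; m<n+m;
         +-mono-≤; *-monoʳ-≤; *-monoˡ-≤; *-mono-≤; +-suc; +-comm; *-comm; *-distribʳ-+; *-distribˡ-+; m∸n+n≡m;
         +-∸-assoc; n∸n≡0; m≤n⇒m<n∨m≡n; <⇒≤pred; ≤-total; m+[n∸m]≡n; *-cancelˡ-≤; *-cancelʳ-<; pred-mono-≤;
         ≤ᵇ⇒≤; m≤m*n; 1≤n!; _!≢0; module ≤-Reasoning)
open import Algebra.Properties.Semiring.Sum +-*-semiring
  using (sum-syntax; ∑-comm; ∑-distrib-+; sum-cong-≗; sum-replicate-zero; *-distribʳ-sum)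
open import Data.Bool using (Bool; true; false; not; _∧_; _∨_; if_then_else_; T)
open import Data.Bool.Properties using (∧-comm; ∧-zeroʳ; ∨-assoc; ∨-comm; if-∧)
open import Data.Empty using (⊥-elim)
open import Data.Fin using (Fin; zero; suc)
open import Data.Fin.Properties as Finₚ using (all?; 0≢1+n) renaming (_≟_ to _≟ᶠ_)
open import Data.Integer as ℤ using (ℤ; +_; -_; -[1+_]; ∣_∣; +<+)
  renaming (_+_ to _+ᶻ_; _-_ to _-ᶻ_; _*_ to _*ᶻ_; _<_ to _<ᶻ_)
open import Data.Integer.Properties
  using (pos-+; pos-*; ∣i-j∣≤∣i∣+∣j∣; ∣i+j∣≤∣i∣+∣j∣; +-inverseʳ; abs-*; ∣-i∣≡∣i∣; ∣i-j∣≡∣j-i∣)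
open import Data.Integer.Tactic.RingSolver using (solve-∀)
open import Data.List using (List; []; _∷_; [_]; length; filter; concatMap; map; tabulate; _++_; allFin; replicate)
open import Data.List.Properties using (filter-++; length-++; map-tabulate; length-tabulate; ++-identityʳ; ++-assoc)
open import Data.Maybe using (Maybe; just; nothing)
open import Data.Nat using (ℕ; zero; suc; _+_; _*_; _≤_; _<_; _!; _∸_; pred; z≤n; s≤s; NonZero)
import Data.Nat.Tactic.RingSolver as NatSolver
open import Data.Product using (Σ; _×_; _,_; proj₁; proj₂)
open import Data.Rational as ℚ using (ℚ; mkℚ; _/_; toℚᵘ; 0ℚ)
  renaming (_+_ to _+ℚ_; _-_ to _-ℚ_; _<_ to _<ℚ_; ∣_∣ to ∣_∣ℚ)
open import Data.Rational.Properties
  using (toℚᵘ-fromℚᵘ; toℚᵘ-injective; toℚᵘ-homo-+; toℚᵘ-homo‿-; toℚᵘ-homo-∣-∣; toℚᵘ-cancel-<)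
open import Data.Rational.Unnormalised as ℚᵘ using (mkℚᵘ; *≡*; *<*)
  renaming (_/_ to _/ᵘ_; _+_ to _+ᵘ_; _-_ to _-ᵘ_; _<_ to _<ᵘ_; _≃_ to _≃ᵘ_)
open import Data.Rational.Unnormalised.Properties using (module ≃-Reasoning)
  renaming (+-cong to +ᵘ-cong; -‿cong to -ᵘ‿cong; ∣-∣-cong to ∣-∣ᵘ-cong; ≃-trans to ≃ᵘ-trans; ≃-sym to ≃ᵘ-sym;
            ≃-reflexive to ≃ᵘ-reflexive; <-respˡ-≃ to <ᵘ-respˡ-≃ᵘ)
open import Data.Sum using (inj₁; inj₂)
open import Function using (_∘_; _⇔_; mk⇔; Equivalence)
open import Level using (Level)
open import Relation.Binary.PropositionalEquality
  using (_≡_; _≢_; refl; sym; trans; cong; cong₂; subst; subst₂; module ≡-Reasoning)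
open import Relation.Nullary using (yes; no; does)
open import Relation.Nullary.Decidable using (_×-dec_; _→-dec_; T?)
open import Relation.Unary using (Pred; Decidable)

private variable
  a b ℓ ℓ′ : Level
  m n : ℕ

count : {A : Set a} {P : Pred A ℓ} → Decidable P → List A → ℕ
count P? xs = length (filter P? xs)

count-++ : {A : Set a} {P : Pred A ℓ} (P? : Decidable P) → ∀ xs ys → count P? (xs ++ ys) ≡ count P? xs + count P? ys
count-++ P? xs ys = trans (cong length (filter-++ P? xs ys)) (length-++ (filter P? xs))

module _ {A : Set a} {P : Pred A ℓ} (P? : Decidable P) where

  count-map : {B : Set b} (f : B → A) → ∀ xs → count P? (map f xs) ≡ count (P? ∘ f) xs
  count-map f [] = refl
  count-map f (x ∷ xs) with does (P? (f x))
  ... | true  = cong suc (count-map f xs)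
  ... | false = count-map f xs

  count-tabulate : (h : Fin m → A) → count P? (tabulate h) ≡ ∑[ i < m ] count P? [ h i ]
  count-tabulate {zero}  h = refl
  count-tabulate {suc m} h =
    trans (count-++ P? [ h zero ] _) (cong (_+_ (count P? [ h zero ])) (count-tabulate (h ∘ suc)))

  count-concatMap-allFin : {B : Set b} (c : Fin m → B → A) → ∀ xs →
    count P? (concatMap (λ x → map (λ i → c i x) (allFin m)) xs) ≡ ∑[ i < m ] count (P? ∘ c i) xs
  count-concatMap-allFin {m = m} c [] = sym (sum-replicate-zero m)
  count-concatMap-allFin {m = m} c (x ∷ xs) = begin
    count P? (map (λ i → c i x) (allFin m) ++ _)
      ≡⟨ count-++ P? (map (λ i → c i x) (allFin m)) _ ⟩
    count P? (map (λ i → c i x) (allFin m)) + count P? (concatMap _ xs)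
      ≡⟨ cong₂ _+_ (trans (cong (count P?) (map-tabulate (λ i → i) (λ i → c i x))) (count-tabulate (λ i → c i x)))
                   (count-concatMap-allFin c xs) ⟩
    ∑[ i < m ] count P? [ c i x ] + ∑[ i < m ] count (P? ∘ c i) xs
      ≡⟨ ∑-distrib-+ (λ i → count P? [ c i x ]) (λ i → count (P? ∘ c i) xs) ⟨
    ∑[ i < m ] (count P? [ c i x ] + count (P? ∘ c i) xs)
      ≡⟨ sum-cong-≗ (λ i → cong (_+ _) (count-map (c i) [ x ])) ⟩
    ∑[ i < m ] (count (P? ∘ c i) [ x ] + count (P? ∘ c i) xs)
      ≡⟨ sum-cong-≗ (λ i → count-++ (P? ∘ c i) [ x ] xs) ⟨
    ∑[ i < m ] count (P? ∘ c i) (x ∷ xs) ∎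
    where open ≡-Reasoning

module _ {A : Set a} {P : Pred A ℓ} {Q : Pred A ℓ′} (P? : Decidable P) (Q? : Decidable Q) where

  count-cong : (∀ x → P x ⇔ Q x) → ∀ xs → count P? xs ≡ count Q? xs
  count-cong P⇔Q [] = refl
  count-cong P⇔Q (x ∷ xs) with P? x | Q? x
  ... | yes _ | yes _ = cong suc (count-cong P⇔Q xs)
  ... | no  _ | no  _ = count-cong P⇔Q xs
  ... | yes p | no ¬q = ⊥-elim (¬q (Equivalence.to (P⇔Q x) p))
  ... | no ¬p | yes q = ⊥-elim (¬p (Equivalence.from (P⇔Q x) q))

  count-guarded : ∀ b → (∀ x → P x ⇔ (T b × Q x)) → ∀ xs →
    count P? xs ≡ (if b then count Q? xs else 0)
  count-guarded true  P⇔Q = count-cong λ x →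
    mk⇔ (proj₂ ∘ Equivalence.to (P⇔Q x)) (λ q → Equivalence.from (P⇔Q x) (_ , q))
  count-guarded false P⇔Q [] = refl
  count-guarded false P⇔Q (x ∷ xs) with P? x
  ... | yes p = ⊥-elim (proj₁ (Equivalence.to (P⇔Q x) p))
  ... | no  _ = count-guarded false P⇔Q xs

-- Rook placements

_≡ᵇ_ : Fin m → Fin m → Bool
i ≡ᵇ j = does (i ≟ᶠ j)

-- A row of a board is given by its forbidden column, if any, and `Occupied m` marks
-- the columns already taken.  `placements U rs` counts the ways to put one rook in each
-- row of rs, in pairwise distinct unoccupied columns and never on a forbidden cell.
Row : ℕ → Set
Row m = Maybe (Fin m)

Occupied : ℕ → Set
Occupied m = Fin m → Bool

permitted : Row m → Fin m → Bool
permitted nothing  j = true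
permitted (just c) j = not (c ≡ᵇ j)

allowed : Occupied m → Row m → Fin m → Bool
allowed U r j = not (U j) ∧ permitted r j

occupy : Occupied m → Fin m → Occupied m
occupy U j i = U i ∨ (j ≡ᵇ i)

placements : Occupied m → List (Row m) → ℕ
placements     U []       = 1
placements {m} U (r ∷ rs) = ∑[ j < m ] (if allowed U r j then placements (occupy U j) rs else 0)

IsPlacement : Occupied m → (Fin n → Row m) → (Fin n → Fin m) → Set
IsPlacement U rows g = (∀ i j → g i ≡ g j → i ≡ j) × (∀ i → T (allowed U (rows i) (g i)))

isPlacement? : (U : Occupied m) (rows : Fin n → Row m) → Decidable (IsPlacement U rows)
isPlacement? U rows g =
  all? (λ i → all? (λ j → (g i ≟ᶠ g j) →-dec (i ≟ᶠ j))) ×-dec all? (λ i → T? (allowed U (rows i) (g i)))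

T-allowed-occupy : (U : Occupied m) (r : Row m) (i j : Fin m) →
  T (allowed (occupy U j) r i) ⇔ (T (allowed U r i) × j ≢ i)
T-allowed-occupy U r i j with U i | j ≟ᶠ i
... | true  | _       = mk⇔ (λ ()) (λ ())
... | false | yes j≡i = mk⇔ (λ ()) (λ (_ , j≢i) → j≢i j≡i)
... | false | no  j≢i = mk⇔ (_, j≢i) proj₁

isPlacement-∷ : (U : Occupied m) (rows : Fin (suc n) → Row m) (h : Fin (suc n) → Fin m) →
  IsPlacement U rows h ⇔
  (T (allowed U (rows zero) (h zero)) × IsPlacement (occupy U (h zero)) (rows ∘ suc) (h ∘ suc))
isPlacement-∷ U rows h = mk⇔ to from
  where
  Rest : Set
  Rest = T (allowed U (rows zero) (h zero)) × IsPlacement (occupy U (h zero)) (rows ∘ suc) (h ∘ suc)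

  occupy⇔ : ∀ i → T (allowed (occupy U (h zero)) (rows (suc i)) (h (suc i))) ⇔
                   (T (allowed U (rows (suc i)) (h (suc i))) × h zero ≢ h (suc i))
  occupy⇔ i = T-allowed-occupy U (rows (suc i)) (h (suc i)) (h zero)

  to : IsPlacement U rows h → Rest
  to (injective , ok) = ok zero
    , (λ i j eq → Finₚ.suc-injective (injective (suc i) (suc j) eq))
    , λ i → Equivalence.from (occupy⇔ i) (ok (suc i) , λ eq → 0≢1+n (injective zero (suc i) eq))

  from : Rest → IsPlacement U rows h
  from (ok₀ , injective , ok) = injective′ , ok′
    where
    avoids₀ : ∀ i → h zero ≢ h (suc i)
    avoids₀ i = proj₂ (Equivalence.to (occupy⇔ i) (ok i))
    injective′ : ∀ i j → h i ≡ h j → i ≡ j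
    injective′ zero    zero    _  = refl
    injective′ zero    (suc j) eq = ⊥-elim (avoids₀ j eq)
    injective′ (suc i) zero    eq = ⊥-elim (avoids₀ i (sym eq))
    injective′ (suc i) (suc j) eq = cong suc (injective i j eq)
    ok′ : ∀ i → T (allowed U (rows i) (h i))
    ok′ zero    = ok₀
    ok′ (suc i) = proj₁ (Equivalence.to (occupy⇔ i) (ok i))

count-isPlacement : ∀ n (U : Occupied m) (rows : Fin n → Row m) →
  count (isPlacement? U rows) (allFuns n m) ≡ placements U (tabulate rows)
count-isPlacement zero U rows with isPlacement? U rows (λ ())
... | yes _ = refl
... | no ¬p = ⊥-elim (¬p ((λ ()) , (λ ())))
count-isPlacement {m} (suc n) U rows = begin
  count (isPlacement? U rows) (allFuns (suc n) m)
    ≡⟨ count-concatMap-allFin (isPlacement? U rows) _ (allFuns n m) ⟩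
  ∑[ j < m ] count (isPlacement? U rows ∘ _) (allFuns n m)
    ≡⟨ sum-cong-≗ (λ j → count-guarded _ (isPlacement? (occupy U j) (rows ∘ suc)) (allowed U (rows zero) j)
                           (λ g → isPlacement-∷ U rows _) (allFuns n m)) ⟩
  ∑[ j < m ] (if allowed U (rows zero) j then count (isPlacement? (occupy U j) (rows ∘ suc)) (allFuns n m) else 0)
    ≡⟨ sum-cong-≗ (λ j → cong (if allowed U (rows zero) j then_else 0)
                               (count-isPlacement n (occupy U j) (rows ∘ suc))) ⟩
  placements U (tabulate rows) ∎
  where open ≡-Reasoning

unoccupied : Occupied m
unoccupied _ = false

T-permitted-just : (c j : Fin m) → T (permitted (just c) j) ⇔ j ≢ c
T-permitted-just c j with c ≟ᶠ j
... | yes c≡j = mk⇔ (λ ()) (λ j≢c → j≢c (sym c≡j))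
... | no  c≢j = mk⇔ (λ _ j≡c → c≢j (sym j≡c)) _

D≡placements : (f : Fin n → Fin n) → D f ≡ placements unoccupied (tabulate (just ∘ f))
D≡placements {n} f = trans
  (count-cong (isDerangement? f) (isPlacement? unoccupied (just ∘ f)) derangement⇔placement (allFuns n n))
  (count-isPlacement n unoccupied (just ∘ f))
  where
  derangement⇔placement : ∀ g → IsDerangement f g ⇔ IsPlacement unoccupied (just ∘ f) g
  derangement⇔placement g = mk⇔
    (λ (injective , avoids) → injective , λ i → Equivalence.from (T-permitted-just (f i) (g i)) (avoids i))
    (λ (injective , ok) → injective , λ i → Equivalence.to (T-permitted-just (f i) (g i)) (ok i))

placements-cong : {U V : Occupied m} → (∀ i → U i ≡ V i) → ∀ rs → placements U rs ≡ placements V rs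
placements-cong U≗V [] = refl
placements-cong U≗V (r ∷ rs) = sum-cong-≗ λ j →
  cong₂ (λ u p → if not u ∧ permitted r j then p else 0) (U≗V j)
        (placements-cong (λ i → cong (_∨ (j ≡ᵇ i)) (U≗V i)) rs)

∑-guarded : ∀ b (f : Fin m → ℕ) → (if b then ∑[ j < m ] f j else 0) ≡ ∑[ j < m ] (if b then f j else 0)
∑-guarded     true  f = refl
∑-guarded {m} false f = sym (sum-replicate-zero m)

placements-two-rows : ∀ (U : Occupied m) r s rs → placements U (r ∷ s ∷ rs) ≡
  ∑[ i < m ] ∑[ j < m ] (if allowed U r i ∧ allowed (occupy U i) s j then placements (occupy (occupy U i) j) rs else 0)
placements-two-rows {m} U r s rs = sum-cong-≗ {m} λ i →
  trans (∑-guarded (allowed U r i) (λ j → if allowed (occupy U i) s j then placements (occupy (occupy U i) j) rs else 0))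
        (sum-cong-≗ {m} λ j → sym (if-∧ (allowed U r i)))

allowed-occupy-comm : ∀ (U : Occupied m) r s i j →
  (allowed U r i ∧ allowed (occupy U i) s j) ≡ (allowed U s j ∧ allowed (occupy U j) r i)
allowed-occupy-comm U r s i j with U i | U j | i ≟ᶠ j | j ≟ᶠ i
... | true  | _     | _     | _     = sym (∧-zeroʳ _)
... | false | true  | _     | _     = ∧-zeroʳ _
... | false | false | yes _ | yes _ = trans (∧-zeroʳ _) (sym (∧-zeroʳ _))
... | false | false | no  _ | no  _ = ∧-comm (permitted r i) (permitted s j)
... | false | false | yes i≡j | no j≢i = ⊥-elim (j≢i (sym i≡j))
... | false | false | no i≢j | yes j≡i = ⊥-elim (i≢j (sym j≡i))

occupy-comm : ∀ (U : Occupied m) i j k → occupy (occupy U i) j k ≡ occupy (occupy U j) i k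
occupy-comm U i j k = trans (∨-assoc (U k) _ _) (trans (cong (U k ∨_) (∨-comm (i ≡ᵇ k) _)) (sym (∨-assoc (U k) _ _)))

placements-swap : ∀ (U : Occupied m) r s rs → placements U (r ∷ s ∷ rs) ≡ placements U (s ∷ r ∷ rs)
placements-swap {m} U r s rs = begin
  placements U (r ∷ s ∷ rs)           ≡⟨ placements-two-rows U r s rs ⟩
  ∑[ i < m ] ∑[ j < m ] pair r s i j  ≡⟨ sum-cong-≗ {m} (λ i → sum-cong-≗ {m} λ j → pair-swap i j) ⟩
  ∑[ i < m ] ∑[ j < m ] pair s r j i  ≡⟨ ∑-comm {m} {m} (λ i j → pair s r j i) ⟩
  ∑[ j < m ] ∑[ i < m ] pair s r j i  ≡⟨ placements-two-rows U s r rs ⟨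
  placements U (s ∷ r ∷ rs)           ∎
  where
  open ≡-Reasoning
  pair : Row m → Row m → Fin m → Fin m → ℕ
  pair r s i j = if allowed U r i ∧ allowed (occupy U i) s j then placements (occupy (occupy U i) j) rs else 0
  pair-swap : ∀ i j → pair r s i j ≡ pair s r j i
  pair-swap i j = cong₂ (if_then_else 0) (allowed-occupy-comm U r s i j) (placements-cong (occupy-comm U i j) rs)

placements-rotate : ∀ (U : Occupied m) r rs → placements U (r ∷ rs) ≡ placements U (rs ++ [ r ])
placements-rotate U r []       = refl
placements-rotate {m} U r (s ∷ rs) = trans (placements-swap U r s rs) (sum-cong-≗ {m} λ j →
  cong (λ p → if allowed U s j then p else 0) (placements-rotate (occupy U j) r rs))

∑-pick : (c : Fin m) (g : Fin m → ℕ) → ∑[ j < m ] (if c ≡ᵇ j then g j else 0) ≡ g c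
∑-pick {suc m} zero    g = trans (cong (_+_ (g zero)) (sum-replicate-zero m)) (+-identityʳ (g zero))
∑-pick {suc m} (suc c) g = ∑-pick c (g ∘ suc)

placements-forbid : ∀ (U : Occupied m) c rs → placements U (nothing ∷ rs) ≡
  placements U (just c ∷ rs) + (if U c then 0 else placements (occupy U c) rs)
placements-forbid {m} U c rs = begin
  ∑[ j < m ] (if allowed U nothing j then X j else 0)
    ≡⟨ sum-cong-≗ {m} split ⟩
  ∑[ j < m ] ((if allowed U (just c) j then X j else 0) + (if c ≡ᵇ j then (if U j then 0 else X j) else 0))
    ≡⟨ ∑-distrib-+ (λ j → if allowed U (just c) j then X j else 0) _ ⟩
  placements U (just c ∷ rs) + ∑[ j < m ] (if c ≡ᵇ j then (if U j then 0 else X j) else 0)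
    ≡⟨ cong (_+_ (placements U (just c ∷ rs))) (∑-pick c (λ j → if U j then 0 else X j)) ⟩
  placements U (just c ∷ rs) + (if U c then 0 else X c) ∎
  where
  open ≡-Reasoning
  X : Fin m → ℕ
  X j = placements (occupy U j) rs
  split : ∀ j → (if allowed U nothing j then X j else 0) ≡
    (if allowed U (just c) j then X j else 0) + (if c ≡ᵇ j then (if U j then 0 else X j) else 0)
  split j with U j | c ≡ᵇ j
  ... | true  | true  = refl
  ... | true  | false = refl
  ... | false | true  = refl
  ... | false | false = sym (+-identityʳ (X j))

vacancies : Occupied m → ℕ
vacancies {m} U = ∑[ j < m ] (if U j then 0 else 1)

vacancies-occupy : ∀ (U : Occupied m) c → U c ≡ false → vacancies U ≡ suc (vacancies (occupy U c))
vacancies-occupy {m} U c Uc≡false = begin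
  vacancies U
    ≡⟨ sum-cong-≗ {m} split ⟩
  ∑[ j < m ] ((if c ≡ᵇ j then (if U j then 0 else 1) else 0) + (if occupy U c j then 0 else 1))
    ≡⟨ ∑-distrib-+ (λ j → if c ≡ᵇ j then (if U j then 0 else 1) else 0) _ ⟩
  ∑[ j < m ] (if c ≡ᵇ j then (if U j then 0 else 1) else 0) + vacancies (occupy U c)
    ≡⟨ cong (_+ vacancies (occupy U c)) (∑-pick c (λ j → if U j then 0 else 1)) ⟩
  (if U c then 0 else 1) + vacancies (occupy U c)
    ≡⟨ cong (λ u → (if u then 0 else 1) + vacancies (occupy U c)) Uc≡false ⟩
  suc (vacancies (occupy U c)) ∎
  where
  open ≡-Reasoning
  split : ∀ j → (if U j then 0 else 1) ≡
    (if c ≡ᵇ j then (if U j then 0 else 1) else 0) + (if occupy U c j then 0 else 1)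
  split j with U j | c ≡ᵇ j
  ... | true  | true  = refl
  ... | true  | false = refl
  ... | false | true  = refl
  ... | false | false = refl

∑-unoccupied : ∀ (U : Occupied m) v → ∑[ j < m ] (if U j then 0 else v) ≡ vacancies U * v
∑-unoccupied {m} U v = trans (sum-cong-≗ {m} λ j → scale (U j)) (sym (*-distribʳ-sum v (λ j → if U j then 0 else 1)))
  where
  scale : ∀ u → (if u then 0 else v) ≡ (if u then 0 else 1) * v
  scale true  = refl
  scale false = sym (+-identityʳ v)

placements-unrestricted : ∀ q (U : Occupied m) → vacancies U ≡ q → placements U (replicate q nothing) ≡ q !
placements-unrestricted     zero    U _ = refl
placements-unrestricted {m} (suc q) U vacancies≡ = begin
  ∑[ j < m ] (if allowed U nothing j then placements (occupy U j) (replicate q nothing) else 0)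
    ≡⟨ sum-cong-≗ {m} step ⟩
  ∑[ j < m ] (if U j then 0 else q !)
    ≡⟨ ∑-unoccupied U (q !) ⟩
  vacancies U * q !
    ≡⟨ cong (_* q !) vacancies≡ ⟩
  suc q ! ∎
  where
  open ≡-Reasoning
  step : ∀ j → (if allowed U nothing j then placements (occupy U j) (replicate q nothing) else 0) ≡ (if U j then 0 else q !)
  step j with U j in Uj
  ... | true  = refl
  ... | false = placements-unrestricted q (occupy U j) (suc-injective (trans (sym (vacancies-occupy U j Uj)) vacancies≡))

-- Permutations avoiding independent cells

i≡i-j+j : ∀ i j → i ≡ i -ᶻ j +ᶻ j
i≡i-j+j = solve-∀

-- avoid n r = ∑ⱼ (-1)ʲ (r choose j) (n-j)! counts the permutations of n points that avoid
-- r given cells lying in distinct rows and columns; avoid n n is the derangement number.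
avoid : ℕ → ℕ → ℤ
avoid n zero    = + (n !)
avoid n (suc r) = avoid n r -ᶻ avoid (pred n) r

avoid-recurrence : ∀ s m → s < m →
  avoid (suc m) (suc s) ≡ + (m ∸ s) *ᶻ avoid m (suc s) +ᶻ + suc s *ᶻ avoid m s
avoid-recurrence zero (suc m) _ = begin
  + (suc (suc m) * (suc m * m !)) -ᶻ + (suc m * m !)
    ≡⟨ cong₂ _-ᶻ_ (trans (pos-* (suc (suc m)) (suc m * m !)) (cong (+ suc (suc m) *ᶻ_) (pos-* (suc m) (m !))))
                  (pos-* (suc m) (m !)) ⟩
  (+ 1 +ᶻ k) *ᶻ (k *ᶻ F) -ᶻ k *ᶻ F
    ≡⟨ identity k F ⟩
  k *ᶻ (k *ᶻ F -ᶻ F) +ᶻ + 1 *ᶻ (k *ᶻ F)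
    ≡⟨ cong (λ kF → k *ᶻ (kF -ᶻ F) +ᶻ + 1 *ᶻ kF) (sym (pos-* (suc m) (m !))) ⟩
  k *ᶻ (+ (suc m * m !) -ᶻ F) +ᶻ + 1 *ᶻ + (suc m * m !) ∎
  where
  open ≡-Reasoning
  k = + suc m
  F = + (m !)
  identity : ∀ k F → (+ 1 +ᶻ k) *ᶻ (k *ᶻ F) -ᶻ k *ᶻ F ≡ k *ᶻ (k *ᶻ F -ᶻ F) +ᶻ + 1 *ᶻ (k *ᶻ F)
  identity = solve-∀
avoid-recurrence (suc s) (suc m) (s≤s s<m) = begin
  avoid (suc (suc m)) (suc s) -ᶻ u₁
    ≡⟨ cong (_-ᶻ u₁) (avoid-recurrence s (suc m) (≤-trans s<m (n≤1+n m))) ⟩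
  + (suc m ∸ s) *ᶻ u₁ +ᶻ j *ᶻ u₀ -ᶻ u₁
    ≡⟨ cong (λ i → + i *ᶻ u₁ +ᶻ j *ᶻ u₀ -ᶻ u₁) (+-∸-assoc 1 (≤-trans (n≤1+n s) s<m)) ⟩
  (+ 1 +ᶻ k) *ᶻ u₁ +ᶻ j *ᶻ u₀ -ᶻ u₁
    ≡⟨ cong (λ u → (+ 1 +ᶻ k) *ᶻ u₁ +ᶻ j *ᶻ u -ᶻ u₁) (i≡i-j+j u₀ v₀) ⟩
  (+ 1 +ᶻ k) *ᶻ u₁ +ᶻ j *ᶻ (u₁ +ᶻ v₀) -ᶻ u₁
    ≡⟨ identity (avoid-recurrence s m s<m) ⟩
  k *ᶻ (u₁ -ᶻ v₁) +ᶻ (+ 1 +ᶻ j) *ᶻ u₁ ∎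
  where
  open ≡-Reasoning
  u₁ = avoid (suc m) (suc s)
  u₀ = avoid (suc m) s
  v₁ = avoid m (suc s)
  v₀ = avoid m s
  k = + (m ∸ s)
  j = + suc s
  expanded : ∀ k j v₁ v₀ →
    (+ 1 +ᶻ k) *ᶻ (k *ᶻ v₁ +ᶻ j *ᶻ v₀) +ᶻ j *ᶻ (k *ᶻ v₁ +ᶻ j *ᶻ v₀ +ᶻ v₀) -ᶻ (k *ᶻ v₁ +ᶻ j *ᶻ v₀)
      ≡ k *ᶻ (k *ᶻ v₁ +ᶻ j *ᶻ v₀ -ᶻ v₁) +ᶻ (+ 1 +ᶻ j) *ᶻ (k *ᶻ v₁ +ᶻ j *ᶻ v₀)
  expanded = solve-∀
  identity : ∀ {u} → u ≡ k *ᶻ v₁ +ᶻ j *ᶻ v₀ →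
    (+ 1 +ᶻ k) *ᶻ u +ᶻ j *ᶻ (u +ᶻ v₀) -ᶻ u ≡ k *ᶻ (u -ᶻ v₁) +ᶻ (+ 1 +ᶻ j) *ᶻ u
  identity refl = expanded k j v₁ v₀

avoid-diagonal-step : ∀ m → avoid (suc (suc m)) (suc (suc m)) ≡ + suc m *ᶻ avoid (suc m) m
avoid-diagonal-step m = begin
  avoid (suc (suc m)) (suc m) -ᶻ A
    ≡⟨ cong (_-ᶻ A) (avoid-recurrence m (suc m) ≤-refl) ⟩
  + (suc m ∸ m) *ᶻ A +ᶻ k *ᶻ avoid (suc m) m -ᶻ A
    ≡⟨ cong (λ i → + i *ᶻ A +ᶻ k *ᶻ avoid (suc m) m -ᶻ A)
            (trans (+-∸-assoc 1 (≤-refl {m})) (cong suc (n∸n≡0 m))) ⟩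
  + 1 *ᶻ A +ᶻ k *ᶻ avoid (suc m) m -ᶻ A
    ≡⟨ cancel A (avoid (suc m) m) k ⟩
  k *ᶻ avoid (suc m) m ∎
  where
  open ≡-Reasoning
  A = avoid (suc m) (suc m)
  k = + suc m
  cancel : ∀ A B k → + 1 *ᶻ A +ᶻ k *ᶻ B -ᶻ A ≡ k *ᶻ B
  cancel = solve-∀

avoid-natural : ∀ n s → s ≤ n → Σ ℕ λ v → avoid n s ≡ + v × v ≤ n !
avoid-natural n       zero    _         = n ! , refl , ≤-refl
avoid-natural (suc m) (suc s) (s≤s s≤m) with m≤n⇒m<n∨m≡n s≤m
... | inj₁ s<m =
  let v₁ , eq₁ , v₁≤ = avoid-natural m (suc s) s<m
      v₂ , eq₂ , v₂≤ = avoid-natural m s s≤m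
  in (m ∸ s) * v₁ + suc s * v₂
   , trans (avoid-recurrence s m s<m)
       (trans (cong₂ (λ u w → + (m ∸ s) *ᶻ u +ᶻ + suc s *ᶻ w) eq₁ eq₂)
              (sym (trans (pos-+ ((m ∸ s) * v₁) (suc s * v₂))
                          (cong₂ _+ᶻ_ (pos-* (m ∸ s) v₁) (pos-* (suc s) v₂)))))
   , (begin
       (m ∸ s) * v₁ + suc s * v₂   ≤⟨ +-mono-≤ (*-monoʳ-≤ (m ∸ s) v₁≤) (*-monoʳ-≤ (suc s) v₂≤) ⟩
       (m ∸ s) * m ! + suc s * m ! ≡⟨ *-distribʳ-+ (m !) (m ∸ s) (suc s) ⟨
       ((m ∸ s) + suc s) * m !     ≡⟨ cong (_* m !) (trans (+-suc (m ∸ s) s) (cong suc (m∸n+n≡m s≤m))) ⟩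
       suc m * m !                 ∎)
  where open ≤-Reasoning
... | inj₂ refl = diagonal s
  where
  diagonal : ∀ m → Σ ℕ λ v → avoid (suc m) (suc m) ≡ + v × v ≤ suc m !
  diagonal zero    = 0 , refl , z≤n
  diagonal (suc m) =
    let v , eq , v≤ = avoid-natural (suc m) m (n≤1+n m)
    in suc m * v
     , trans (avoid-diagonal-step m) (trans (cong (+ suc m *ᶻ_) eq) (sym (pos-* (suc m) v)))
     , (begin
         suc m * v         ≤⟨ *-monoʳ-≤ (suc m) v≤ ⟩
         suc m * suc m !   ≤⟨ *-monoˡ-≤ (suc m !) (n≤1+n (suc m)) ⟩
         suc (suc m) * suc m ! ∎)
    where open ≤-Reasoning

∣avoid∣≤ : ∀ n s → s ≤ n → ∣ avoid n s ∣ ≤ n !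
∣avoid∣≤ n s s≤n with avoid-natural n s s≤n
... | v , eq , v≤ = subst (_≤ n !) (cong ∣_∣ (sym eq)) v≤

avoid-lipschitz : ∀ N s t → s + t ≤ N → ∣ avoid N (s + t) -ᶻ avoid N s ∣ ≤ t * pred N !
avoid-lipschitz N s zero    _ rewrite +-identityʳ s | +-inverseʳ (avoid N s) = z≤n
avoid-lipschitz N s (suc t) s+t<N rewrite +-suc s t = begin
  ∣ avoid N (s + t) -ᶻ avoid (pred N) (s + t) -ᶻ avoid N s ∣
    ≡⟨ cong ∣_∣ (swap (avoid N (s + t)) (avoid N s) (avoid (pred N) (s + t))) ⟩
  ∣ avoid N (s + t) -ᶻ avoid N s -ᶻ avoid (pred N) (s + t) ∣
    ≤⟨ ∣i-j∣≤∣i∣+∣j∣ (avoid N (s + t) -ᶻ avoid N s) (avoid (pred N) (s + t)) ⟩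
  ∣ avoid N (s + t) -ᶻ avoid N s ∣ + ∣ avoid (pred N) (s + t) ∣
    ≤⟨ +-mono-≤ (avoid-lipschitz N s t (≤-trans (n≤1+n _) s+t<N)) (∣avoid∣≤ (pred N) (s + t) (<⇒≤pred s+t<N)) ⟩
  t * pred N ! + pred N !
    ≡⟨ +-comm (t * pred N !) _ ⟩
  suc t * pred N ! ∎
  where
  open ≤-Reasoning
  swap : ∀ a b c → a -ᶻ c -ᶻ b ≡ a -ᶻ b -ᶻ c
  swap = solve-∀

derangements : ℕ → ℤ
derangements n = avoid n n

derangements-suc : ∀ m → derangements (suc m) ≡ + suc m *ᶻ derangements m +ᶻ sign (suc m)
derangements-suc zero    = refl
derangements-suc (suc m) = begin
  avoid (suc (suc m)) (suc (suc m))
    ≡⟨ avoid-diagonal-step m ⟩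
  k *ᶻ B
    ≡⟨ cong (k *ᶻ_) (i≡i-j+j B E) ⟩
  k *ᶻ (B -ᶻ E +ᶻ E)
    ≡⟨ cong (λ A → k *ᶻ (A +ᶻ E)) (derangements-suc m) ⟩
  k *ᶻ (k *ᶻ E +ᶻ σ +ᶻ E)
    ≡⟨ expanded k E σ ⟩
  (+ 1 +ᶻ k) *ᶻ (k *ᶻ E +ᶻ σ) -ᶻ σ
    ≡⟨ cong (λ A → (+ 1 +ᶻ k) *ᶻ A -ᶻ σ) (derangements-suc m) ⟨
  + suc (suc m) *ᶻ derangements (suc m) +ᶻ sign (suc (suc m)) ∎
  where
  open ≡-Reasoning
  k = + suc m
  B = avoid (suc m) m
  E = derangements m
  σ = sign (suc m)
  expanded : ∀ k E σ → k *ᶻ (k *ᶻ E +ᶻ σ +ᶻ E) ≡ (+ 1 +ᶻ k) *ᶻ (k *ᶻ E +ᶻ σ) -ᶻ σ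
  expanded = solve-∀

-- n! m! (dₙ/n! − dₘ/m!), where dₙ = derangements n.
cross : ℕ → ℕ → ℤ
cross n m = derangements n *ᶻ + (m !) -ᶻ derangements m *ᶻ + (n !)

cross-suc : ∀ n m → cross n (suc m) ≡ + suc m *ᶻ cross n m -ᶻ sign (suc m) *ᶻ + (n !)
cross-suc n m = begin
  derangements n *ᶻ + (suc m * m !) -ᶻ derangements (suc m) *ᶻ + (n !)
    ≡⟨ cong₂ (λ a b → derangements n *ᶻ a -ᶻ b *ᶻ + (n !)) (pos-* (suc m) (m !)) (derangements-suc m) ⟩
  derangements n *ᶻ (+ suc m *ᶻ + (m !)) -ᶻ (+ suc m *ᶻ derangements m +ᶻ sign (suc m)) *ᶻ + (n !)
    ≡⟨ expanded (derangements n) (+ (m !)) (+ suc m) (sign (suc m)) (derangements m) (+ (n !)) ⟩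
  + suc m *ᶻ cross n m -ᶻ sign (suc m) *ᶻ + (n !) ∎
  where
  open ≡-Reasoning
  expanded : ∀ a b k σ c d → a *ᶻ (k *ᶻ b) -ᶻ (k *ᶻ c +ᶻ σ) *ᶻ d ≡ k *ᶻ (a *ᶻ b -ᶻ c *ᶻ d) -ᶻ σ *ᶻ d
  expanded = solve-∀

∣sign∣ : ∀ k → ∣ sign k ∣ ≡ 1
∣sign∣ zero    = refl
∣sign∣ (suc k) = trans (∣-i∣≡∣i∣ (sign k)) (∣sign∣ k)

∣cross∣+n!≤ : ∀ n j → 1 ≤ n → ∣ cross n (n + j) ∣ + n ! ≤ (n + j) !
∣cross∣+n!≤ n zero    _ rewrite +-identityʳ n | +-inverseʳ (derangements n *ᶻ + (n !)) = ≤-refl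
∣cross∣+n!≤ n (suc j) 1≤n rewrite +-suc n j = begin
  ∣ cross n (suc k) ∣ + n !
    ≡⟨ cong (λ c → ∣ c ∣ + n !) (cross-suc n k) ⟩
  ∣ + suc k *ᶻ cross n k -ᶻ sign (suc k) *ᶻ + (n !) ∣ + n !
    ≤⟨ +-mono-≤ (∣i-j∣≤∣i∣+∣j∣ (+ suc k *ᶻ cross n k) (sign (suc k) *ᶻ + (n !))) ≤-refl ⟩
  ∣ + suc k *ᶻ cross n k ∣ + ∣ sign (suc k) *ᶻ + (n !) ∣ + n !
    ≡⟨ cong₂ (λ a b → a + b + n !) (abs-* (+ suc k) (cross n k))
             (trans (abs-* (sign (suc k)) (+ (n !))) (cong (_* n !) (∣sign∣ (suc k)))) ⟩
  suc k * ∣ cross n k ∣ + 1 * n ! + n !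
    ≡⟨ regroup (suc k * ∣ cross n k ∣) (n !) ⟩
  suc k * ∣ cross n k ∣ + 2 * n !
    ≤⟨ +-mono-≤ (≤-refl {suc k * ∣ cross n k ∣}) (*-monoˡ-≤ (n !) (s≤s (≤-trans 1≤n (m≤m+n n j)))) ⟩
  suc k * ∣ cross n k ∣ + suc k * n !
    ≡⟨ *-distribˡ-+ (suc k) ∣ cross n k ∣ (n !) ⟨
  suc k * (∣ cross n k ∣ + n !)
    ≤⟨ *-monoʳ-≤ (suc k) (∣cross∣+n!≤ n j 1≤n) ⟩
  suc k * k ! ∎
  where
  open ≤-Reasoning
  k = n + j
  regroup : ∀ x y → x + 1 * y + y ≡ x + 2 * y
  regroup = NatSolver.solve-∀

∣cross∣≤m! : ∀ n m → 1 ≤ n → n ≤ m → ∣ cross n m ∣ ≤ m !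
∣cross∣≤m! n m 1≤n n≤m = subst (λ m → ∣ cross n m ∣ ≤ m !) (m+[n∸m]≡n n≤m)
  (≤-trans (m≤m+n _ (n !)) (∣cross∣+n!≤ n (m ∸ n) 1≤n))

∣cross∣≤ : ∀ n m → 1 ≤ n → 1 ≤ m → ∣ cross n m ∣ ≤ n ! + m !
∣cross∣≤ n m 1≤n 1≤m with ≤-total n m
... | inj₁ n≤m = ≤-trans (∣cross∣≤m! n m 1≤n n≤m) (m≤n+m (m !) (n !))
... | inj₂ m≤n = begin
  ∣ cross n m ∣ ≡⟨ ∣i-j∣≡∣j-i∣ (derangements n *ᶻ + (m !)) _ ⟩
  ∣ cross m n ∣ ≤⟨ ∣cross∣≤m! m n 1≤m m≤n ⟩
  n !           ≤⟨ m≤m+n (n !) (m !) ⟩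
  n ! + m !     ∎
  where open ≤-Reasoning

-- Deletion–contraction

liveCount : Occupied m → List (Fin m) → ℕ
liveCount U []       = 0
liveCount U (h ∷ hs) = if U h then liveCount U hs else suc (liveCount U hs)

occurrences : Fin m → List (Fin m) → ℕ
occurrences c []       = 0
occurrences c (h ∷ hs) = if c ≡ᵇ h then suc (occurrences c hs) else occurrences c hs

liveOccurrences : Occupied m → Fin m → List (Fin m) → ℕ
liveOccurrences U c []       = 0
liveOccurrences U c (h ∷ hs) =
  if U h then liveOccurrences U c hs else (if c ≡ᵇ h then suc (liveOccurrences U c hs) else liveOccurrences U c hs)

liveCount≤length : (U : Occupied m) → ∀ hs → liveCount U hs ≤ length hs
liveCount≤length U []       = z≤n
liveCount≤length U (h ∷ hs) with U h
... | true  = ≤-trans (liveCount≤length U hs) (n≤1+n _)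
... | false = s≤s (liveCount≤length U hs)

liveCount-occupy : (U : Occupied m) → ∀ c hs → liveCount U hs ≡ liveCount (occupy U c) hs + liveOccurrences U c hs
liveCount-occupy U c []       = refl
liveCount-occupy U c (h ∷ hs) with U h | c ≡ᵇ h
... | true  | _     = liveCount-occupy U c hs
... | false | true  = trans (cong suc (liveCount-occupy U c hs)) (sym (+-suc _ _))
... | false | false = cong suc (liveCount-occupy U c hs)

liveOccurrences≤occurrences : (U : Occupied m) → ∀ c hs → liveOccurrences U c hs ≤ occurrences c hs
liveOccurrences≤occurrences U c []       = z≤n
liveOccurrences≤occurrences U c (h ∷ hs) with U h | c ≡ᵇ h
... | true  | true  = ≤-trans (liveOccurrences≤occurrences U c hs) (n≤1+n _)
... | true  | false = liveOccurrences≤occurrences U c hs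
... | false | true  = s≤s (liveOccurrences≤occurrences U c hs)
... | false | false = liveOccurrences≤occurrences U c hs

occurrences-∷ : ∀ K (h : Fin m) hs → (∀ c → occurrences c (h ∷ hs) ≤ suc K) → ∀ c → occurrences c hs ≤ suc K
occurrences-∷ K h hs occ≤ c with c ≡ᵇ h | occ≤ c
... | true  | occ≤c = ≤-trans (n≤1+n _) occ≤c
... | false | occ≤c = occ≤c

occurrences-head : ∀ K (h : Fin m) hs → (∀ c → occurrences c (h ∷ hs) ≤ suc K) → occurrences h hs ≤ K
occurrences-head K h hs occ≤ with h ≟ᶠ h | occ≤ h
... | yes _ | s≤s occ≤h = occ≤h
... | no h≢h | _ = ⊥-elim (h≢h refl)

board : List (Fin m) → ℕ → List (Row m)
board hs q = map just hs ++ replicate q nothing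

board-free-row : (hs : List (Fin m)) → ∀ q → board hs q ++ [ nothing ] ≡ board hs (suc q)
board-free-row hs q = trans (++-assoc (map just hs) (replicate q nothing) _) (cong (map just hs ++_) (replicate-snoc q))
  where
  replicate-snoc : ∀ q → replicate q nothing ++ [ nothing ] ≡ replicate {A = Row m} (suc q) nothing
  replicate-snoc zero    = refl
  replicate-snoc (suc q) = cong (nothing ∷_) (replicate-snoc q)

placements-relax : (U : Occupied m) (h : Fin m) → ∀ hs q → placements U (board hs (suc q)) ≡
  placements U (board (h ∷ hs) q) + (if U h then 0 else placements (occupy U h) (board hs q))
placements-relax U h hs q = begin
  placements U (board hs (suc q))            ≡⟨ cong (placements U) (board-free-row hs q) ⟨
  placements U (board hs q ++ [ nothing ])   ≡⟨ placements-rotate U nothing (board hs q) ⟨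
  placements U (nothing ∷ board hs q)        ≡⟨ placements-forbid U h (board hs q) ⟩
  _ ∎
  where open ≡-Reasoning

errorBound : ℕ → ℕ → ℕ
errorBound n zero    = 0
errorBound n (suc p) = errorBound n p + errorBound (pred n) p + pred (pred n) !

errorBound-mono : ∀ n p → errorBound n p ≤ errorBound n (suc p)
errorBound-mono n p = ≤-trans (m≤m+n (errorBound n p) (errorBound (pred n) p)) (m≤m+n _ _)

deletion-triangle : ∀ (x y b c c′ : ℤ) → ∣ x -ᶻ (b -ᶻ c) ∣ ≤ ∣ x +ᶻ y -ᶻ b ∣ + ∣ y -ᶻ c′ ∣ + ∣ c -ᶻ c′ ∣
deletion-triangle x y b c c′ = begin
  ∣ x -ᶻ (b -ᶻ c) ∣
    ≡⟨ cong ∣_∣ (regroup x y b c c′) ⟩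
  ∣ (x +ᶻ y -ᶻ b) -ᶻ (y -ᶻ c′) +ᶻ (c -ᶻ c′) ∣
    ≤⟨ ∣i+j∣≤∣i∣+∣j∣ ((x +ᶻ y -ᶻ b) -ᶻ (y -ᶻ c′)) (c -ᶻ c′) ⟩
  ∣ (x +ᶻ y -ᶻ b) -ᶻ (y -ᶻ c′) ∣ + ∣ c -ᶻ c′ ∣
    ≤⟨ +-mono-≤ (∣i-j∣≤∣i∣+∣j∣ (x +ᶻ y -ᶻ b) (y -ᶻ c′)) ≤-refl ⟩
  ∣ x +ᶻ y -ᶻ b ∣ + ∣ y -ᶻ c′ ∣ + ∣ c -ᶻ c′ ∣ ∎
  where
  open ≤-Reasoning
  regroup : ∀ x y b c c′ → x -ᶻ (b -ᶻ c) ≡ (x +ᶻ y -ᶻ b) -ᶻ (y -ᶻ c′) +ᶻ (c -ᶻ c′)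
  regroup = solve-∀

-- N counts the placements with the first row's cell forbidden, Nd those with that restriction
-- deleted and Nc those with a rook on it, so N = Nd − Nc mirrors the defining recurrence of avoid.
-- Contraction turns t ≤ K further constraints dead, which avoid-lipschitz prices at t · pred n !.
contraction-step : ∀ K n L (N Nc Nd : ℕ) r rc t → Nd ≡ N + Nc → r ≡ rc + t → r ≤ n → t ≤ K →
  ∣ + Nd -ᶻ avoid (suc n) r ∣ ≤ K * errorBound (suc n) L → ∣ + Nc -ᶻ avoid n rc ∣ ≤ K * errorBound n L →
  ∣ + N -ᶻ avoid (suc n) (suc r) ∣ ≤ K * errorBound (suc n) (suc L)
contraction-step K n L N Nc Nd r rc t Nd≡ r≡ r≤n t≤K Nd≈ Nc≈ = begin
  ∣ + N -ᶻ (avoid (suc n) r -ᶻ avoid n r) ∣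
    ≤⟨ deletion-triangle (+ N) (+ Nc) (avoid (suc n) r) (avoid n r) (avoid n rc) ⟩
  ∣ + N +ᶻ + Nc -ᶻ avoid (suc n) r ∣ + ∣ + Nc -ᶻ avoid n rc ∣ + ∣ avoid n r -ᶻ avoid n rc ∣
    ≡⟨ cong (λ x → ∣ x -ᶻ avoid (suc n) r ∣ + ∣ + Nc -ᶻ avoid n rc ∣ + ∣ avoid n r -ᶻ avoid n rc ∣)
         (trans (sym (pos-+ N Nc)) (cong +_ (sym Nd≡))) ⟩
  ∣ + Nd -ᶻ avoid (suc n) r ∣ + ∣ + Nc -ᶻ avoid n rc ∣ + ∣ avoid n r -ᶻ avoid n rc ∣
    ≤⟨ +-mono-≤ (+-mono-≤ Nd≈ Nc≈) shifted ⟩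
  K * errorBound (suc n) L + K * errorBound n L + K * pred n !
    ≡⟨ trans (*-distribˡ-+ K (errorBound (suc n) L + errorBound n L) _)
             (cong (_+ K * pred n !) (*-distribˡ-+ K (errorBound (suc n) L) (errorBound n L))) ⟨
  K * errorBound (suc n) (suc L) ∎
  where
  open ≤-Reasoning
  shifted : ∣ avoid n r -ᶻ avoid n rc ∣ ≤ K * pred n !
  shifted = subst (λ r → ∣ avoid n r -ᶻ avoid n rc ∣ ≤ K * pred n !) (sym r≡)
    (≤-trans (avoid-lipschitz n rc t (subst (_≤ n) r≡ r≤n)) (*-monoˡ-≤ (pred n !) t≤K))

placements-approx : ∀ K (U : Occupied m) hs q n → length hs + q ≡ n → vacancies U ≡ n →
  (∀ c → occurrences c hs ≤ suc K) →
  ∣ + placements U (board hs q) -ᶻ avoid n (liveCount U hs) ∣ ≤ K * errorBound n (length hs)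
placements-approx K U []       q n refl vac≡ occ≤
  rewrite placements-unrestricted q U vac≡ | +-inverseʳ (+ (q !)) = z≤n
placements-approx K U (h ∷ hs) q zero    () vac≡ occ≤
placements-approx K U (h ∷ hs) q (suc n) len≡ vac≡ occ≤ with U h in Uh
... | true = begin
  ∣ + N -ᶻ avoid (suc n) r ∣
    ≡⟨ cong (λ x → ∣ + x -ᶻ avoid (suc n) r ∣) relax≡ ⟨
  ∣ + placements U (board hs (suc q)) -ᶻ avoid (suc n) r ∣
    ≤⟨ placements-approx K U hs (suc q) (suc n) (trans (+-suc L q) len≡) vac≡ (occurrences-∷ K h hs occ≤) ⟩
  K * errorBound (suc n) L
    ≤⟨ *-monoʳ-≤ K (errorBound-mono (suc n) L) ⟩
  K * errorBound (suc n) (suc L) ∎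
  where
  open ≤-Reasoning
  L = length hs
  N = placements U (board (h ∷ hs) q)
  r = liveCount U hs
  relax≡ : placements U (board hs (suc q)) ≡ N
  relax≡ = trans (placements-relax U h hs q)
    (trans (cong (λ u → N + (if u then 0 else placements (occupy U h) (board hs q))) Uh) (+-identityʳ N))
... | false = contraction-step K n (length hs) N Nc _ r rc t
  (trans (placements-relax U h hs q) (cong (λ u → N + (if u then 0 else Nc)) Uh))
  (liveCount-occupy U h hs)
  (≤-trans (liveCount≤length U hs) (≤-trans (m≤m+n (length hs) q) (≤-reflexive (suc-injective len≡))))
  (≤-trans (liveOccurrences≤occurrences U h hs) (occurrences-head K h hs occ≤))
  (placements-approx K U hs (suc q) (suc n) (trans (+-suc (length hs) q) len≡) vac≡ (occurrences-∷ K h hs occ≤))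
  (placements-approx K (occupy U h) hs q n (suc-injective len≡)
    (suc-injective (trans (sym (vacancies-occupy U h Uh)) vac≡)) (occurrences-∷ K h hs occ≤))
  where
  N = placements U (board (h ∷ hs) q)
  Nc = placements (occupy U h) (board hs q)
  r = liveCount U hs
  rc = liveCount (occupy U h) hs
  t = liveOccurrences U h hs

-- The errorBound (pred n) terms of the first p steps sum to at most 3 p (p − 1) (n − 3)! / 2;
-- the statement is doubled to avoid the fraction.
doubled-errorBound≤ : ∀ n → (∀ p → p ≤ pred n → errorBound (pred n) p ≤ 3 * p * pred (pred (pred n)) !) →
  ∀ p → p ≤ n → 2 * errorBound n p ≤ 2 * p * pred (pred n) ! + 3 * (p * pred p) * pred (pred (pred n)) !
doubled-errorBound≤ n IH zero    _   = z≤n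
doubled-errorBound≤ n IH (suc p) p<n = begin
  2 * (errorBound n p + errorBound (pred n) p + F)
    ≡⟨ distribute (errorBound n p) (errorBound (pred n) p) F ⟩
  2 * errorBound n p + 2 * errorBound (pred n) p + 2 * F
    ≤⟨ +-mono-≤ (+-mono-≤ (doubled-errorBound≤ n IH p (≤-trans (n≤1+n p) p<n)) (*-monoʳ-≤ 2 (IH p (<⇒≤pred p<n))))
                ≤-refl ⟩
  2 * p * F + 3 * (p * pred p) * X + 2 * (3 * p * X) + 2 * F
    ≡⟨ collect p F X (p * pred p) ⟩
  2 * suc p * F + 3 * (p * pred p + 2 * p) * X
    ≡⟨ cong (λ T → 2 * suc p * F + 3 * T * X) (triangular p) ⟩
  2 * suc p * F + 3 * (suc p * p) * X ∎
  where
  open ≤-Reasoning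
  F = pred (pred n) !
  X = pred (pred (pred n)) !
  distribute : ∀ a b c → 2 * (a + b + c) ≡ 2 * a + 2 * b + 2 * c
  distribute = NatSolver.solve-∀
  collect : ∀ p F X T → 2 * p * F + 3 * T * X + 2 * (3 * p * X) + 2 * F ≡ 2 * suc p * F + 3 * (T + 2 * p) * X
  collect = NatSolver.solve-∀
  triangular : ∀ p → p * pred p + 2 * p ≡ suc p * p
  triangular zero    = refl
  triangular (suc p) = shift p
    where
    shift : ∀ p → suc p * p + 2 * suc p ≡ suc (suc p) * suc p
    shift = NatSolver.solve-∀

-- The induction closes only from n = 5 on, where 3 (n − 1) ≤ 4 (n − 2); smaller n are evaluated.
errorBound≤ : ∀ n p → p ≤ n → errorBound n p ≤ 3 * p * pred (pred n) !
errorBound≤ 0 0 _ = z≤n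
errorBound≤ 1 0 _ = z≤n
errorBound≤ 1 1 _ = ≤ᵇ⇒≤ _ _ _
errorBound≤ 2 0 _ = z≤n
errorBound≤ 2 1 _ = ≤ᵇ⇒≤ _ _ _
errorBound≤ 2 2 _ = ≤ᵇ⇒≤ _ _ _
errorBound≤ 3 0 _ = z≤n
errorBound≤ 3 1 _ = ≤ᵇ⇒≤ _ _ _
errorBound≤ 3 2 _ = ≤ᵇ⇒≤ _ _ _
errorBound≤ 3 3 _ = ≤ᵇ⇒≤ _ _ _
errorBound≤ 4 0 _ = z≤n
errorBound≤ 4 1 _ = ≤ᵇ⇒≤ _ _ _
errorBound≤ 4 2 _ = ≤ᵇ⇒≤ _ _ _
errorBound≤ 4 3 _ = ≤ᵇ⇒≤ _ _ _
errorBound≤ 4 4 _ = ≤ᵇ⇒≤ _ _ _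
errorBound≤ n@(suc (suc (suc (suc (suc m))))) p p≤n = *-cancelˡ-≤ 2 (begin
  2 * errorBound n p
    ≤⟨ doubled-errorBound≤ n (errorBound≤ (suc (suc (suc (suc m))))) p p≤n ⟩
  2 * p * F + 3 * (p * pred p) * X
    ≤⟨ +-mono-≤ (≤-refl {2 * p * F}) (*-monoˡ-≤ X (*-monoʳ-≤ 3 (*-monoʳ-≤ p (pred-mono-≤ p≤n)))) ⟩
  2 * p * F + 3 * (p * (4 + m)) * X
    ≡⟨ cong (_+_ (2 * p * F)) (reassociate p m X) ⟩
  2 * p * F + p * (3 * (4 + m)) * X
    ≤⟨ +-mono-≤ (≤-refl {2 * p * F}) (*-monoˡ-≤ X (*-monoʳ-≤ p (3[4+m]≤4[3+m] m))) ⟩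
  2 * p * F + p * (4 * (3 + m)) * X
    ≡⟨ collect p m X ⟩
  2 * (3 * p * F) ∎)
  where
  open ≤-Reasoning
  F = (3 + m) !
  X = (2 + m) !
  reassociate : ∀ p m X → 3 * (p * (4 + m)) * X ≡ p * (3 * (4 + m)) * X
  reassociate = NatSolver.solve-∀
  collect : ∀ p m X → 2 * p * ((3 + m) * X) + p * (4 * (3 + m)) * X ≡ 2 * (3 * p * ((3 + m) * X))
  collect = NatSolver.solve-∀
  3[4+m]≤4[3+m] : ∀ m → 3 * (4 + m) ≤ 4 * (3 + m)
  3[4+m]≤4[3+m] m = ≤-trans (≤-reflexive (expand₁ m)) (≤-trans (m≤m+n (12 + 3 * m) m) (≤-reflexive (expand₂ m)))
    where
    expand₁ : ∀ m → 3 * (4 + m) ≡ 12 + 3 * m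
    expand₁ = NatSolver.solve-∀
    expand₂ : ∀ m → 12 + 3 * m + m ≡ 4 * (3 + m)
    expand₂ = NatSolver.solve-∀
errorBound≤ 1 (suc (suc p)) (s≤s ())
errorBound≤ 2 (suc (suc (suc p))) (s≤s (s≤s ()))
errorBound≤ 3 (suc (suc (suc (suc p)))) (s≤s (s≤s (s≤s ())))
errorBound≤ 4 (suc (suc (suc (suc (suc p))))) (s≤s (s≤s (s≤s (s≤s ()))))

-- Convergence

occurrences-map : (f : Fin n → Fin m) → ∀ c xs → occurrences c (map f xs) ≡ count (λ x → c ≟ᶠ f x) xs
occurrences-map f c []       = refl
occurrences-map f c (x ∷ xs) with does (c ≟ᶠ f x)
... | true  = cong suc (occurrences-map f c xs)
... | false = occurrences-map f c xs

occurrences≤ : ∀ {k} (f : Fin n → Fin n) → KMax k f → ∀ c → occurrences c (tabulate f) ≤ k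
occurrences≤ {n} f kmax c = subst (_≤ _) preimages≡occurrences (kmax c)
  where
  preimages≡occurrences : preimageCount f c ≡ occurrences c (tabulate f)
  preimages≡occurrences = trans (count-cong _ _ (λ _ → mk⇔ sym sym) (allFin n))
    (trans (sym (occurrences-map f c (allFin n))) (cong (occurrences c) (map-tabulate (λ i → i) f)))

liveCount-unoccupied : (hs : List (Fin m)) → liveCount unoccupied hs ≡ length hs
liveCount-unoccupied []       = refl
liveCount-unoccupied (h ∷ hs) = cong suc (liveCount-unoccupied hs)

vacancies-unoccupied : ∀ m → vacancies (unoccupied {m}) ≡ m
vacancies-unoccupied zero    = refl
vacancies-unoccupied (suc m) = cong suc (vacancies-unoccupied m)

derangements-approx : ∀ K (f : Fin n → Fin n) → KMax (suc K) f →
  ∣ + D f -ᶻ derangements n ∣ ≤ K * (3 * n * pred (pred n) !)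
derangements-approx {n} K f kmax = begin
  ∣ + D f -ᶻ avoid n n ∣
    ≡⟨ cong₂ (λ N r → ∣ + N -ᶻ avoid n r ∣) D≡ (sym (trans (liveCount-unoccupied hs) length≡)) ⟩
  ∣ + placements unoccupied (board hs 0) -ᶻ avoid n (liveCount unoccupied hs) ∣
    ≤⟨ placements-approx K unoccupied hs 0 n (trans (+-identityʳ _) length≡) (vacancies-unoccupied n)
                         (occurrences≤ f kmax) ⟩
  K * errorBound n (length hs)
    ≡⟨ cong (λ L → K * errorBound n L) length≡ ⟩
  K * errorBound n n
    ≤⟨ *-monoʳ-≤ K (errorBound≤ n n ≤-refl) ⟩
  K * (3 * n * pred (pred n) !) ∎
  where
  open ≤-Reasoning
  hs = tabulate f
  length≡ : length hs ≡ n
  length≡ = length-tabulate f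
  D≡ : D f ≡ placements unoccupied (board hs 0)
  D≡ = trans (D≡placements f) (cong (placements unoccupied) (sym (trans (++-identityʳ (map just hs)) (map-tabulate f just))))

D-cross≤ : ∀ K {n} m (f : Fin n → Fin n) → KMax (suc K) f → 1 ≤ n → 1 ≤ m →
  ∣ + D f *ᶻ + (m !) -ᶻ derangements m *ᶻ + (n !) ∣ ≤ K * (3 * n * pred (pred n) !) * m ! + (n ! + m !)
D-cross≤ K {n} m f kmax 1≤n 1≤m = begin
  ∣ + D f *ᶻ + (m !) -ᶻ derangements m *ᶻ + (n !) ∣
    ≡⟨ cong ∣_∣ (split (+ D f) (derangements n) (+ (m !)) (derangements m) (+ (n !))) ⟩
  ∣ (+ D f -ᶻ derangements n) *ᶻ + (m !) +ᶻ cross n m ∣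
    ≤⟨ ∣i+j∣≤∣i∣+∣j∣ ((+ D f -ᶻ derangements n) *ᶻ + (m !)) (cross n m) ⟩
  ∣ (+ D f -ᶻ derangements n) *ᶻ + (m !) ∣ + ∣ cross n m ∣
    ≡⟨ cong (_+ ∣ cross n m ∣) (abs-* (+ D f -ᶻ derangements n) (+ (m !))) ⟩
  ∣ + D f -ᶻ derangements n ∣ * m ! + ∣ cross n m ∣
    ≤⟨ +-mono-≤ (*-monoˡ-≤ (m !) (derangements-approx K f kmax)) (∣cross∣≤ n m 1≤n 1≤m) ⟩
  K * (3 * n * pred (pred n) !) * m ! + (n ! + m !) ∎
  where
  open ≤-Reasoning
  split : ∀ a d c e f → a *ᶻ c -ᶻ e *ᶻ f ≡ (a -ᶻ d) *ᶻ c +ᶻ (d *ᶻ c -ᶻ e *ᶻ f)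
  split = solve-∀

n≤n! : ∀ n → n ≤ n !
n≤n! zero    = z≤n
n≤n! (suc n) = m≤m*n (suc n) (n !) {{n !≢0}}

cross-bound-scaled : ∀ K M n₂ m → M ≤ suc n₂ → M ≤ m →
  (K * (3 * (2 + n₂) * n₂ !) * m ! + ((2 + n₂) ! + m !)) * M ≤ (3 * K + 2) * ((2 + n₂) ! * m !)
cross-bound-scaled K M n₂ m M≤ M≤m = begin
  (K * (3 * N * n₂ !) * m ! + (N ! + m !)) * M
    ≡⟨ distribute (K * (3 * N * n₂ !) * m !) (N !) (m !) M ⟩
  K * (3 * N * n₂ !) * m ! * M + N ! * M + m ! * M
    ≤⟨ +-mono-≤ (+-mono-≤ first (*-monoʳ-≤ (N !) (≤-trans M≤m (n≤n! m))))
                (*-monoʳ-≤ (m !) (≤-trans (≤-trans M≤ (n≤1+n (suc n₂))) (n≤n! N))) ⟩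
  3 * K * W + N ! * m ! + m ! * N !
    ≡⟨ cong (λ x → 3 * K * W + W + x) (*-comm (m !) (N !)) ⟩
  3 * K * W + W + W
    ≡⟨ collect K W ⟩
  (3 * K + 2) * W ∎
  where
  open ≤-Reasoning
  N = 2 + n₂
  W = N ! * m !
  distribute : ∀ x y z M → (x + (y + z)) * M ≡ x * M + y * M + z * M
  distribute = NatSolver.solve-∀
  collect : ∀ K W → 3 * K * W + W + W ≡ (3 * K + 2) * W
  collect = NatSolver.solve-∀
  factorial : ∀ K n₂ F mf → (3 * K * mf) * ((2 + n₂) * F * (1 + n₂)) ≡ 3 * K * (((2 + n₂) * ((1 + n₂) * F)) * mf)
  factorial = NatSolver.solve-∀
  reassociate : ∀ K N F mf M → K * (3 * N * F) * mf * M ≡ (3 * K * mf) * (N * F * M)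
  reassociate = NatSolver.solve-∀
  first : K * (3 * N * n₂ !) * m ! * M ≤ 3 * K * W
  first = begin
    K * (3 * N * n₂ !) * m ! * M      ≡⟨ reassociate K N (n₂ !) (m !) M ⟩
    3 * K * m ! * (N * n₂ ! * M)      ≤⟨ *-monoʳ-≤ (3 * K * m !) (*-monoʳ-≤ (N * n₂ !) M≤) ⟩
    3 * K * m ! * (N * n₂ ! * suc n₂) ≡⟨ factorial K n₂ (n₂ !) (m !) ⟩
    3 * K * W                         ∎

-- Beyond the threshold 3K/(n − 1) + 1/n! + 1/m! < 1/(q + 1).
threshold : ℕ → ℕ → ℕ
threshold K q = 2 + suc q * (3 * K + 2)

cross-bound-small : ∀ K p q n m A → threshold K q ≤ n → threshold K q ≤ m →
  A ≤ K * (3 * n * pred (pred n) !) * m ! + (n ! + m !) → A * suc q < suc p * (n ! * m !)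
cross-bound-small K p q (suc (suc n₂)) m A (s≤s (s≤s c≤n₂)) N≤m A≤ =
  ≤-trans (*-cancelʳ-< M (A * suc q) W scaled) (m≤m+n W (p * W))
  where
  open ≤-Reasoning
  c = suc q * (3 * K + 2)
  M = suc c
  W = suc (suc n₂) ! * m !
  scaled : A * suc q * M < W * M
  scaled = begin-strict
    A * suc q * M           ≡⟨ rearrange A (suc q) M ⟩
    A * M * suc q           ≤⟨ *-monoˡ-≤ (suc q) (≤-trans (*-monoˡ-≤ M A≤)
                                 (cross-bound-scaled K M n₂ m (s≤s c≤n₂) (≤-trans (n≤1+n M) N≤m))) ⟩
    (3 * K + 2) * W * suc q ≡⟨ rearrange′ K W (suc q) ⟩
    c * W                   <⟨ m<n+m (c * W) (*-mono-≤ (1≤n! (suc (suc n₂))) (1≤n! m)) ⟩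
    W + c * W               ≡⟨ *-comm M W ⟩
    W * M                   ∎
    where
    rearrange : ∀ A Q M → A * Q * M ≡ A * M * Q
    rearrange = NatSolver.solve-∀
    rearrange′ : ∀ K W Q → (3 * K + 2) * W * Q ≡ Q * (3 * K + 2) * W
    rearrange′ = NatSolver.solve-∀

toℚᵘ-/ : ∀ i d .{{_ : NonZero d}} → toℚᵘ (i / d) ≃ᵘ (i /ᵘ d)
toℚᵘ-/ i (suc d) = toℚᵘ-fromℚᵘ (mkℚᵘ i d)

/ᵘ-+-/ᵘ : ∀ (a c : ℤ) b k .{{_ : NonZero b}} .{{_ : NonZero (k * b)}} →
  (a /ᵘ b) +ᵘ (c /ᵘ (k * b)) ≃ᵘ ((+ k *ᶻ a +ᶻ c) /ᵘ (k * b))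
/ᵘ-+-/ᵘ a c b@(suc _) k@(suc _) = *≡* (begin
  (a *ᶻ + (k * b) +ᶻ c *ᶻ + b) *ᶻ + (k * b)
    ≡⟨ cong (λ x → (a *ᶻ x +ᶻ c *ᶻ + b) *ᶻ x) (pos-* k b) ⟩
  (a *ᶻ (+ k *ᶻ + b) +ᶻ c *ᶻ + b) *ᶻ (+ k *ᶻ + b)
    ≡⟨ expanded a c (+ k) (+ b) ⟩
  (+ k *ᶻ a +ᶻ c) *ᶻ (+ b *ᶻ (+ k *ᶻ + b))
    ≡⟨ cong (λ x → (+ k *ᶻ a +ᶻ c) *ᶻ (+ b *ᶻ x)) (pos-* k b) ⟨
  (+ k *ᶻ a +ᶻ c) *ᶻ (+ b *ᶻ + (k * b))
    ≡⟨ cong ((+ k *ᶻ a +ᶻ c) *ᶻ_) (pos-* b (k * b)) ⟨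
  (+ k *ᶻ a +ᶻ c) *ᶻ + (b * (k * b)) ∎)
  where
  open ≡-Reasoning
  expanded : ∀ a c k b → (a *ᶻ (k *ᶻ b) +ᶻ c *ᶻ b) *ᶻ (k *ᶻ b) ≡ (k *ᶻ a +ᶻ c) *ᶻ (b *ᶻ (k *ᶻ b))
  expanded = solve-∀

invESum≡ : ∀ m → invESum m ≡ (derangements m / m !) {{m !≢0}}
invESum≡ zero    = refl
invESum≡ (suc m) = toℚᵘ-injective (begin
  toℚᵘ (invESum m +ℚ (sign (suc m) / suc m !) {{suc m !≢0}})
    ≈⟨ toℚᵘ-homo-+ (invESum m) _ ⟩
  toℚᵘ (invESum m) +ᵘ toℚᵘ ((sign (suc m) / suc m !) {{suc m !≢0}})
    ≈⟨ +ᵘ-cong (≃ᵘ-trans (≃ᵘ-reflexive (cong toℚᵘ (invESum≡ m))) (toℚᵘ-/ (derangements m) (m !) {{m !≢0}}))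
               (toℚᵘ-/ (sign (suc m)) (suc m !) {{suc m !≢0}}) ⟩
  (derangements m /ᵘ m !) {{m !≢0}} +ᵘ (sign (suc m) /ᵘ suc m !) {{suc m !≢0}}
    ≈⟨ /ᵘ-+-/ᵘ (derangements m) (sign (suc m)) (m !) (suc m) {{m !≢0}} {{suc m !≢0}} ⟩
  ((+ suc m *ᶻ derangements m +ᶻ sign (suc m)) /ᵘ suc m !) {{suc m !≢0}}
    ≈⟨ ≃ᵘ-reflexive (cong (λ i → (i /ᵘ suc m !) {{suc m !≢0}}) (derangements-suc m)) ⟨
  (derangements (suc m) /ᵘ suc m !) {{suc m !≢0}}
    ≈⟨ toℚᵘ-/ (derangements (suc m)) (suc m !) {{suc m !≢0}} ⟨
  toℚᵘ ((derangements (suc m) / suc m !) {{suc m !≢0}}) ∎)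
  where open ≃-Reasoning

∣/ᵘ-/ᵘ∣< : ∀ (a c : ℤ) b d P q .{{_ : NonZero b}} .{{_ : NonZero d}} →
  ∣ a *ᶻ + d -ᶻ c *ᶻ + b ∣ * suc q < P * (b * d) → ℚᵘ.∣ (a /ᵘ b) -ᵘ (c /ᵘ d) ∣ <ᵘ mkℚᵘ (+ P) q
∣/ᵘ-/ᵘ∣< a c b@(suc _) d@(suc _) P q cross< = *<* (subst₂ _<ᶻ_
  (pos-* ∣ a *ᶻ + d +ᶻ (- c) *ᶻ + b ∣ (suc q)) (pos-* P (b * d))
  (+<+ (subst (λ x → ∣ x ∣ * suc q < P * (b * d)) (minus-as-plus a c (+ b) (+ d)) cross<)))
  where
  minus-as-plus : ∀ a c b d → a *ᶻ d -ᶻ c *ᶻ b ≡ a *ᶻ d +ᶻ (- c) *ᶻ b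
  minus-as-plus = solve-∀

∣/-/∣< : ∀ (a c : ℤ) b d .{{_ : NonZero b}} .{{_ : NonZero d}} (ε : ℚ) p → ℚ.numerator ε ≡ + suc p →
  ∣ a *ᶻ + d -ᶻ c *ᶻ + b ∣ * ℚ.denominatorℕ ε < suc p * (b * d) → ∣ (a / b) -ℚ (c / d) ∣ℚ <ℚ ε
∣/-/∣< a c b d ε@(mkℚ _ q _) p refl cross< =
  toℚᵘ-cancel-< (<ᵘ-respˡ-≃ᵘ (≃ᵘ-sym toℚᵘ-∣/-/∣) (∣/ᵘ-/ᵘ∣< a c b d (suc p) q cross<))
  where
  toℚᵘ-∣/-/∣ : toℚᵘ ∣ (a / b) -ℚ (c / d) ∣ℚ ≃ᵘ ℚᵘ.∣ (a /ᵘ b) -ᵘ (c /ᵘ d) ∣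
  toℚᵘ-∣/-/∣ = ≃ᵘ-trans (toℚᵘ-homo-∣-∣ ((a / b) -ℚ (c / d)))
    (∣-∣ᵘ-cong (≃ᵘ-trans (toℚᵘ-homo-+ (a / b) (ℚ.- (c / d)))
      (+ᵘ-cong (toℚᵘ-/ a b) (≃ᵘ-trans (toℚᵘ-homo‿- (c / d)) (-ᵘ‿cong (toℚᵘ-/ c d))))))

numerator-positive : ∀ ε → 0ℚ <ℚ ε → Σ ℕ λ p → ℚ.numerator ε ≡ + suc p
numerator-positive (mkℚ (+ suc p)  _ _) _   = p , refl
numerator-positive (mkℚ (+ zero)   _ _) 0<ε = ⊥-elim (ℤ.Positive.pos (ℚ.positive 0<ε))
numerator-positive (mkℚ -[1+ _ ]   _ _) 0<ε = ⊥-elim (ℤ.Positive.pos (ℚ.positive 0<ε))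

theorem1 : (k : ℕ) → 1 ≤ k → (f : (n : ℕ) → Fin n → Fin n) →
  ((n : ℕ) → KMax k (f n)) →
  ConvergesToInvE (λ n → ratio (f n))
theorem1 zero    () f kmax
theorem1 (suc K) _  f kmax ε 0<ε = threshold K q , close
  where
  p = proj₁ (numerator-positive ε 0<ε)
  q = ℚ.denominator-1 ε
  close : ∀ n m → threshold K q ≤ n → threshold K q ≤ m → ∣ ratio (f n) -ℚ invESum m ∣ℚ <ℚ ε
  close n m N≤n N≤m = subst (λ y → ∣ ratio (f n) -ℚ y ∣ℚ <ℚ ε) (sym (invESum≡ m))
    (∣/-/∣< (+ D (f n)) (derangements m) (n !) (m !) {{n !≢0}} {{m !≢0}} ε p (proj₂ (numerator-positive ε 0<ε))
      (cross-bound-small K p q n m _ N≤n N≤m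
        (D-cross≤ K m (f n) (kmax n) (≤-trans (s≤s z≤n) N≤n) (≤-trans (s≤s z≤n) N≤m))))
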